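{- Suppose that a $\mathsf{PHHF}(2;\kappa,(w_1,w_2),2)$ exists and $n\ge 3$. Then: (i) for every integer $k\ge 1$, a $\mathsf{PHHF}(n;3\kappa+(n-3)k,(\kappa+(n-3)k+w_1+w_2)^3(3\kappa+(n-4)k+1)^{n-3},2n-2)$ exists; (ii) if $w_1+w_2\le 2\kappa$, a $\mathsf{PHF}(n;(2n-3)\kappa-(n-3)(w_1+w_2-1),(2n-5)\kappa-(n-4)(w_1+w_2-1)+1,2n-2)$ exists.
   Context: An $\mathsf{HHF}(N;k,(w_1,\dots,w_N))$ is an $N\times k$ array in which row $i$ contains at most $w_i$ distinct symbols. A $\mathsf{PHHF}(N;k,(w_1,\dots,w_N),t)$ is an $\mathsf{HHF}(N;k,(w_1,\dots,w_N))$ such that for every set of $t$ columns there is a row in which the entries in these $t$ columns are pairwise distinct; when all $w_i=w$ it is written $\mathsf{PHF}(N;k,w,t)$. Exponential notation $x_1^{u_1}\cdots x_c^{u_c}$ for the symbol-count vector means the $\sum u_i$ rows can be partitioned into classes, the $i$th class consisting of $u_i$ rows each containing at most $x_i$ symbols. -}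

module Defs where

open import Data.Nat using (ℕ; _<ᵇ_)
open import Data.Fin using (Fin; toℕ)
open import Data.Bool using (if_then_else_)
open import Data.Product using (∃)
open import Function.Definitions using (Injective)
open import Relation.Binary.PropositionalEquality using (_≡_)

HHF : (N k : ℕ) → (Fin N → ℕ) → Set
HHF N k w = (i : Fin N) → Fin k → Fin (w i)

IsPerfect : {N k : ℕ} {w : Fin N → ℕ} → HHF N k w → ℕ → Set
IsPerfect {N} {k} A t =
  (c : Fin t → Fin k) → Injective _≡_ _≡_ c →
  ∃ λ (i : Fin N) → Injective _≡_ _≡_ (λ j → A i (c j))

PHHF : (N k : ℕ) → (Fin N → ℕ) → ℕ → Set
PHHF N k w t = ∃ λ (A : HHF N k w) → IsPerfect A t

PHF : (N k v t : ℕ) → Set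
PHF N k v t = PHHF N k (λ _ → v) t

pow3 : {N : ℕ} → ℕ → ℕ → Fin N → ℕ
pow3 a b i = if toℕ i <ᵇ 3 then a else b

pair : ℕ → ℕ → Fin 2 → ℕ
pair w1 w2 Fin.zero = w1
pair w1 w2 (Fin.suc _) = w2

-- Write n = 3 + m. The columns are three copies (groups 0, 1, 2) of the κ
-- columns of the given PHHF P and m blocks of k fresh columns. Top row r shows
-- column x of group a through row `third r a` of the array (identity; P₀; P₁),
-- so each top row reads one group through the identity and the other two
-- through the rows of P, and gives every fresh column a private symbol. Block
-- row j merges block j into a single symbol and separates all other columns.
-- If t chosen columns collide in every row, each block row needs two chosen
-- columns in its block, and the three top rows need five chosen copy columns: a
-- top-row collision is a pair inside one group merged by a row of P; two top
-- rows colliding in the same group use different rows of P, hence (P being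
-- perfect) different pairs, i.e. three columns; and no group serves all three
-- top rows, one of which reads it through the identity. So t ≥ 2m + 5 = 2n − 1.

module Submission where

open import Defs
open import Level using (0ℓ)
open import Data.Nat using (ℕ; zero; suc; _+_; _*_; _∸_; _≤_; _≥_; s≤s)
open import Data.Nat.Properties
  using (+-assoc; +-comm; *-comm; +-cancelʳ-≡; +-cancelˡ-≤; m+n∸m≡n; m∸n+n≡m; n≤1+n; ≤-refl; ≤-reflexive; ≤-trans; <-irrefl)
open import Data.Nat.Tactic.RingSolver using (solve-∀)
open import Data.Integer using (ℤ; +_) renaming (_+_ to _+ℤ_; _*_ to _*ℤ_; _-_ to _-ℤ_)
open import Data.Integer.Properties using (pos-+; pos-*; ⊖-≥; m-n≡m⊖n)
import Data.Integer.Tactic.RingSolver as ℤ-Solver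
open import Data.Fin using (Fin; zero; suc; splitAt; remQuot; inject≤; punchOut)
open import Data.Fin.Properties
  using (any?; all?; punchOut-injective; injective⇒≤; inject≤-injective; +↔⊎; *↔×) renaming (_≟_ to _≟ᶠ_)
open import Data.Product using (_×_; _,_; ∃; ∃₂; proj₁; proj₂)
open import Data.Sum using (_⊎_; inj₁; inj₂; [_,_]′)
open import Data.Sum.Properties using (inj₁-injective; inj₂-injective)
open import Data.Sum.Function.Propositional using (_⊎-↣_; _⊎-↔_)
open import Data.Empty using (⊥-elim)
open import Data.Vec using (Vec; lookup; _∷_; [])
open import Data.Vec.Relation.Unary.All using (All; _∷_; [])
open import Data.Vec.Relation.Unary.All.Properties using (lookup⁺)
open import Data.Vec.Relation.Unary.AllPairs using (_∷_; [])
open import Data.Vec.Relation.Unary.Unique.Propositional using (Unique)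
open import Data.Vec.Relation.Unary.Unique.Propositional.Properties using (lookup-injective)
open import Function using (_∘_; _↣_; _↔_; Inverse; Injection)
open import Function.Definitions using (Injective)
open import Function.Construct.Composition using (_↣-∘_; _↔-∘_)
open import Function.Construct.Identity using (↣-id)
open import Function.Construct.Symmetry using (↔-sym)
open import Function.Properties.Inverse using (↔⇒↣)
open import Relation.Binary.Definitions using (DecidableEquality)
open import Relation.Binary.PropositionalEquality
  using (_≡_; _≢_; refl; sym; trans; cong; cong₂; subst; subst₂; module ≡-Reasoning)
open import Relation.Nullary using (¬_; Dec; yes; no; ¬?)
open import Relation.Nullary.Decidable using (_×-dec_; decidable-stable; toWitness)
open import Relation.Unary using (Pred; _∈_; _⊆_; _∪_; _⊥_; _⊢_)

private
  variable
    A B : Set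
    N k t s s′ a b : ℕ
    w v : Fin N → ℕ

pattern one = suc zero
pattern two = suc (suc zero)

-- Collisions and perfect hashing

Collision : (Fin t → B) → Set
Collision f = ∃₂ λ p q → p ≢ q × f p ≡ f q

collision? : DecidableEquality B → (f : Fin t → B) → Dec (Collision f)
collision? _≟_ f = any? λ p → any? λ q → ¬? (p ≟ᶠ q) ×-dec (f p ≟ f q)

¬collision⇒injective : {f : Fin t → B} → ¬ Collision f → Injective _≡_ _≡_ f
¬collision⇒injective ¬collision {p} {q} fp≡fq =
  decidable-stable (p ≟ᶠ q) λ p≢q → ¬collision (p , q , p≢q , fp≡fq)

injective? : DecidableEquality B → (f : Fin t → B) → Dec (Injective _≡_ _≡_ f)
injective? _≟_ f with collision? _≟_ f
... | yes (p , q , p≢q , fp≡fq) = no λ f-injective → p≢q (f-injective fp≡fq)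
... | no ¬collision = yes (¬collision⇒injective ¬collision)

¬injective⇒collision : DecidableEquality B → {f : Fin t → B} → ¬ Injective _≡_ _≡_ f → Collision f
¬injective⇒collision _≟_ {f} ¬injective =
  decidable-stable (collision? _≟_ f) (¬injective ∘ ¬collision⇒injective)

collision-∘ : {g : A → B} {f : Fin t → A} → Injective _≡_ _≡_ g → Collision (g ∘ f) → Collision f
collision-∘ g-injective (p , q , p≢q , e) = p , q , p≢q , g-injective e

IsPerfect-unless-all-collide : {A : HHF N k w} →
  ((c : Fin t → Fin k) → Injective _≡_ _≡_ c → ¬ (∀ i → Collision (A i ∘ c))) →
  IsPerfect A t
IsPerfect-unless-all-collide {A = A} no-total-collision c c-injective = decidable-stable
  (any? λ i → injective? _≟ᶠ_ (A i ∘ c))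
  λ ¬separated → no-total-collision c c-injective λ i →
    ¬injective⇒collision _≟ᶠ_ λ separates → ¬separated (i , separates)

PHHF-mono : (∀ i → w i ≤ v i) → PHHF N k w t → PHHF N k v t
PHHF-mono w≤v (A , A-perfect) =
  (λ i x → inject≤ (A i x) (w≤v i)) ,
  λ c c-injective → let i , separates = A-perfect c c-injective in
    i , λ e → separates (inject≤-injective _ _ _ _ e)

pow3≤ : ∀ {m a b} → (Fin m → b ≤ a) → (i : Fin (3 + m)) → pow3 a b i ≤ a
pow3≤ _   zero                = ≤-refl
pow3≤ _   one                 = ≤-refl
pow3≤ _   two                 = ≤-refl
pow3≤ b≤a (suc (suc (suc j))) = b≤a j

IsPerfect₂⇒separates : {A : HHF N k w} → IsPerfect A 2 →
  ∀ {x y} → x ≢ y → ¬ (∀ i → A i x ≡ A i y)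
IsPerfect₂⇒separates A-perfect {x} {y} x≢y unseparated
  with A-perfect (lookup (x ∷ y ∷ [])) (lookup-injective ((x≢y ∷ []) ∷ [] ∷ []) _ _)
... | i , separates with separates {zero} {suc zero} (unseparated i)
... | ()

-- Counting distinct elements

record AtLeast (s : ℕ) (X : Pred A 0ℓ) : Set where
  field
    elem           : Fin s → A
    elem-injective : Injective _≡_ _≡_ elem
    elem-∈         : ∀ i → elem i ∈ X

open AtLeast

AtLeast-≤ : {X : Pred (Fin t) 0ℓ} → AtLeast s X → s ≤ t
AtLeast-≤ W = injective⇒≤ (elem-injective W)

AtLeast-mono : {X Y : Pred A 0ℓ} → X ⊆ Y → AtLeast s X → AtLeast s Y
AtLeast-mono X⊆Y W = record
  { elem = elem W ; elem-injective = elem-injective W ; elem-∈ = X⊆Y ∘ elem-∈ W }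

AtLeast-shrink : {X : Pred A 0ℓ} → s′ ≤ s → AtLeast s X → AtLeast s′ X
AtLeast-shrink s′≤s W = record
  { elem           = λ i → elem W (inject≤ i s′≤s)
  ; elem-injective = λ e → inject≤-injective _ _ _ _ (elem-injective W e)
  ; elem-∈         = λ i → elem-∈ W (inject≤ i s′≤s)
  }

AtLeast-fromVec : {X : Pred A 0ℓ} (xs : Vec A s) → Unique xs → All X xs → AtLeast s X
AtLeast-fromVec xs xs-unique xs∈X = record
  { elem           = lookup xs
  ; elem-injective = lookup-injective xs-unique _ _
  ; elem-∈         = lookup⁺ xs∈X
  }

AtLeast-pair : {X : Pred A 0ℓ} {p q : A} → p ≢ q → p ∈ X → q ∈ X → AtLeast 2 X
AtLeast-pair p≢q p∈X q∈X = AtLeast-fromVec (_ ∷ _ ∷ []) ((p≢q ∷ []) ∷ [] ∷ []) (p∈X ∷ q∈X ∷ [])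

AtLeast-triple : {X : Pred A 0ℓ} {p q r : A} → p ≢ q → p ≢ r → q ≢ r →
  p ∈ X → q ∈ X → r ∈ X → AtLeast 3 X
AtLeast-triple p≢q p≢r q≢r p∈X q∈X r∈X =
  AtLeast-fromVec (_ ∷ _ ∷ _ ∷ []) ((p≢q ∷ p≢r ∷ []) ∷ (q≢r ∷ []) ∷ [] ∷ [])
    (p∈X ∷ q∈X ∷ r∈X ∷ [])

AtLeast-∪ : {X Y : Pred A 0ℓ} → AtLeast a X → AtLeast b Y → X ⊥ Y → AtLeast (a + b) (X ∪ Y)
AtLeast-∪ {a = a} {X = X} {Y = Y} U V X⊥Y = record
  { elem           = [ elem U , elem V ]′ ∘ splitAt a
  ; elem-injective = Injection.injective (↔⇒↣ +↔⊎) ∘ [,]-injective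
  ; elem-∈         = [,]-∈ ∘ splitAt a
  }
  where
  apart : ∀ i j → elem U i ≢ elem V j
  apart i j e = X⊥Y (elem-∈ U i , subst (_∈ Y) (sym e) (elem-∈ V j))
  [,]-injective : Injective _≡_ _≡_ [ elem U , elem V ]′
  [,]-injective {inj₁ i} {inj₁ j} e = cong inj₁ (elem-injective U e)
  [,]-injective {inj₁ i} {inj₂ j} e = ⊥-elim (apart i j e)
  [,]-injective {inj₂ i} {inj₁ j} e = ⊥-elim (apart j i (sym e))
  [,]-injective {inj₂ i} {inj₂ j} e = cong inj₂ (elem-injective V e)
  [,]-∈ : ∀ z → [ elem U , elem V ]′ z ∈ X ∪ Y
  [,]-∈ (inj₁ i) = inj₁ (elem-∈ U i)
  [,]-∈ (inj₂ j) = inj₂ (elem-∈ V j)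

AtLeast-⋃ : {m : ℕ} {X : Fin m → Pred A 0ℓ} → (∀ j → AtLeast s (X j)) →
  (∀ {j j′ x} → x ∈ X j → x ∈ X j′ → j ≡ j′) →
  AtLeast (m * s) (λ x → ∃ λ j → x ∈ X j)
AtLeast-⋃ {A = A} {s = s} {m = m} {X = X} W X-disjoint = record
  { elem           = elem′ ∘ remQuot s
  ; elem-injective = Injection.injective (↔⇒↣ (*↔× {m})) ∘ elem′-injective
  ; elem-∈         = λ i → proj₁ (remQuot {m} s i) , elem-∈ (W _) _
  }
  where
  elem′ : Fin m × Fin s → A
  elem′ (j , i) = elem (W j) i
  elem′-injective : Injective _≡_ _≡_ elem′
  elem′-injective {j , i} {j′ , i′} e
    with X-disjoint {j} {j′} (elem-∈ (W j) i) (subst (_∈ X j′) (sym e) (elem-∈ (W j′) i′))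
  ... | refl = cong (j ,_) (elem-injective (W j) e)

point-outside-pair : DecidableEquality A → {p q p′ q′ : A} → p′ ≢ q′ →
  ¬ ((p′ ≡ p × q′ ≡ q) ⊎ (p′ ≡ q × q′ ≡ p)) →
  ∃ λ z → z ≢ p × z ≢ q × (z ≡ p′ ⊎ z ≡ q′)
point-outside-pair _≟_ {p} {q} {p′} {q′} p′≢q′ other-pair
  with p′ ≟ p | p′ ≟ q | q′ ≟ p | q′ ≟ q
... | no p′≢p  | no p′≢q  | _        | _        = p′ , p′≢p , p′≢q , inj₁ refl
... | _        | _        | no q′≢p  | no q′≢q  = q′ , q′≢p , q′≢q , inj₂ refl
... | yes p′≡p | _        | yes q′≡p | _        = ⊥-elim (p′≢q′ (trans p′≡p (sym q′≡p)))
... | yes p′≡p | _        | _        | yes q′≡q = ⊥-elim (other-pair (inj₁ (p′≡p , q′≡q)))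
... | _        | yes p′≡q | yes q′≡p | _        = ⊥-elim (other-pair (inj₂ (p′≡q , q′≡p)))
... | _        | yes p′≡q | _        | yes q′≡q = ⊥-elim (p′≢q′ (trans p′≡q (sym q′≡q)))

-- The construction

join↣ : A ↣ Fin a → B ↣ Fin b → (A ⊎ B) ↣ Fin (a + b)
join↣ f g = ↔⇒↣ (↔-sym +↔⊎) ↣-∘ (f ⊎-↣ g)

combine↣ : (Fin a × Fin b) ↣ Fin (a * b)
combine↣ = ↔⇒↣ (↔-sym *↔×)

punchOut∸ : {m : ℕ} {j j′ : Fin m} → j ≢ j′ → Fin (m ∸ 1)
punchOut∸ {suc _} = punchOut

punchOut∸-injective : {m : ℕ} {j j₁ j₂ : Fin m} (j≢j₁ : j ≢ j₁) (j≢j₂ : j ≢ j₂) →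
  punchOut∸ j≢j₁ ≡ punchOut∸ j≢j₂ → j₁ ≡ j₂
punchOut∸-injective {suc _} = punchOut-injective

-- −(r + a) in ℤ/3: a symmetric Latin square.
third : Fin 3 → Fin 3 → Fin 3
third zero zero = zero
third zero one  = two
third zero two  = one
third one  zero = two
third one  one  = one
third one  two  = zero
third two  zero = one
third two  one  = zero
third two  two  = two

third-comm : ∀ r a → third r a ≡ third a r
third-comm = toWitness {a? = all? λ r → all? λ a → third r a ≟ᶠ third a r} _

third-involutive : ∀ r a → third r (third r a) ≡ a
third-involutive = toWitness {a? = all? λ r → all? λ a → third r (third r a) ≟ᶠ a} _

third-injectiveʳ : ∀ r {a a′} → third r a ≡ third r a′ → a ≡ a′
third-injectiveʳ r {a} {a′} e =
  trans (sym (third-involutive r a)) (trans (cong (third r) e) (third-involutive r a′))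

third-injectiveˡ : ∀ {r r′} a → third r a ≡ third r′ a → r ≡ r′
third-injectiveˡ {r} {r′} a e = third-injectiveʳ a (trans (third-comm a r) (trans e (third-comm r′ a)))

Column : ℕ → ℕ → ℕ → Set
Column κ m k = (Fin 3 × Fin κ) ⊎ (Fin m × Fin k)

pattern copy a x = inj₁ (a , x)
pattern block j y = inj₂ (j , y)

module _ {κ m k : ℕ} where

  InCopy : Fin 3 → Pred (Column κ m k) 0ℓ
  InCopy a u = ∃ λ x → u ≡ copy a x

  InBlock : Fin m → Pred (Column κ m k) 0ℓ
  InBlock j u = ∃ λ y → u ≡ block j y

  IsCopy IsBlock : Pred (Column κ m k) 0ℓ
  IsCopy u = ∃ λ a → u ∈ InCopy a
  IsBlock u = ∃ λ j → u ∈ InBlock j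

  copy-injective : ∀ {a a′ x x′} → _≡_ {A = Column κ m k} (copy a x) (copy a′ x′) → x ≡ x′
  copy-injective refl = refl

  InCopy-disjoint : ∀ {a a′} → a ≢ a′ → InCopy a ⊥ InCopy a′
  InCopy-disjoint a≢a′ ((_ , refl) , (_ , refl)) = a≢a′ refl

  InBlock-unique : ∀ {j j′ u} → u ∈ InBlock j → u ∈ InBlock j′ → j ≡ j′
  InBlock-unique (_ , refl) (_ , refl) = refl

  IsBlock⊥IsCopy : IsBlock ⊥ IsCopy
  IsBlock⊥IsCopy ((_ , _ , refl) , (_ , _ , ()))

  columnIndex : Fin (3 * κ + m * k) ↔ Column κ m k
  columnIndex = (*↔× ⊎-↔ *↔×) ↔-∘ +↔⊎

module Construction {κ w₁ w₂ : ℕ} (P : HHF 2 κ (pair w₁ w₂)) (P-perfect : IsPerfect P 2) (m k : ℕ) where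

  TopSymbol : Set
  TopSymbol = ((Fin κ ⊎ (Fin m × Fin k)) ⊎ Fin w₁) ⊎ Fin w₂

  base : Fin 3 → Fin κ → TopSymbol
  base zero x = inj₁ (inj₁ (inj₁ x))
  base one  x = inj₁ (inj₂ (P zero x))
  base two  x = inj₂ (P one x)

  base-zero-injective : ∀ {x y} → base zero x ≡ base zero y → x ≡ y
  base-zero-injective refl = refl

  base-kind : ∀ d d′ {x y} → base d x ≡ base d′ y → d ≡ d′
  base-kind zero zero _ = refl
  base-kind one  one  _ = refl
  base-kind two  two  _ = refl
  base-kind zero one  ()
  base-kind zero two  ()
  base-kind one  zero ()
  base-kind one  two  ()
  base-kind two  zero ()
  base-kind two  one  ()

  P-separates : ∀ {x y} → x ≢ y → base one x ≡ base one y → base two x ≢ base two y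
  P-separates x≢y e₁ e₂ = IsPerfect₂⇒separates {A = P} P-perfect x≢y λ where
    zero → inj₂-injective (inj₁-injective e₁)
    one  → inj₂-injective e₂

  base-collides-at-most-once : ∀ {d d′ x y} → x ≢ y →
    base d x ≡ base d y → base d′ x ≡ base d′ y → d ≡ d′
  base-collides-at-most-once {zero} x≢y e _ = ⊥-elim (x≢y (base-zero-injective e))
  base-collides-at-most-once {d′ = zero} x≢y _ e′ = ⊥-elim (x≢y (base-zero-injective e′))
  base-collides-at-most-once {one} {one} _ _ _ = refl
  base-collides-at-most-once {two} {two} _ _ _ = refl
  base-collides-at-most-once {one} {two} x≢y e e′ = ⊥-elim (P-separates x≢y e e′)
  base-collides-at-most-once {two} {one} x≢y e e′ = ⊥-elim (P-separates x≢y e′ e)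

  base≢block : ∀ d {x j y} → base d x ≢ inj₁ (inj₁ (inj₂ (j , y)))
  base≢block zero ()
  base≢block one  ()
  base≢block two  ()

  topRow : Fin 3 → Column κ m k → TopSymbol
  topRow r (copy a x)  = base (third r a) x
  topRow r (block j y) = inj₁ (inj₁ (inj₂ (j , y)))

  topRow-collision : ∀ r u v → topRow r u ≡ topRow r v → u ≢ v →
    ∃ λ a → ∃₂ λ x y → u ≡ copy a x × v ≡ copy a y × x ≢ y × base (third r a) x ≡ base (third r a) y
  topRow-collision r (copy a x) (copy a′ y) e u≢v with third-injectiveʳ r (base-kind _ _ e)
  ... | refl = a , x , y , refl , refl , (λ x≡y → u≢v (cong (copy a) x≡y)) , e
  topRow-collision r (copy a x)  (block j y) e _ = ⊥-elim (base≢block (third r a) e)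
  topRow-collision r (block j y) (copy a x)  e _ = ⊥-elim (base≢block (third r a) (sym e))
  topRow-collision r (block j y) (block j′ y′) refl u≢v = ⊥-elim (u≢v refl)

  BlockSymbol : Set
  BlockSymbol = ((Fin 3 × Fin κ) ⊎ (Fin (m ∸ 1) × Fin k)) ⊎ Fin 1

  blockSymbol : {j j′ : Fin m} → Dec (j ≡ j′) → Fin k → BlockSymbol
  blockSymbol (yes _)    y = inj₂ zero
  blockSymbol (no j≢j′) y = inj₁ (inj₂ (punchOut∸ j≢j′ , y))

  blockRow : Fin m → Column κ m k → BlockSymbol
  blockRow j (copy a x)   = inj₁ (inj₁ (a , x))
  blockRow j (block j′ y) = blockSymbol (j ≟ᶠ j′) y

  blockSymbol≢copy : ∀ {j j′ y a x} (d : Dec (j ≡ j′)) → blockSymbol d y ≢ inj₁ (inj₁ (a , x))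
  blockSymbol≢copy (yes _) ()
  blockSymbol≢copy (no _)  ()

  blockSymbol-collision : ∀ {j j₁ j₂ y₁ y₂} (d₁ : Dec (j ≡ j₁)) (d₂ : Dec (j ≡ j₂)) →
    blockSymbol d₁ y₁ ≡ blockSymbol d₂ y₂ → (j₁ , y₁) ≢ (j₂ , y₂) →
    block j₁ y₁ ∈ InBlock {κ} j × block j₂ y₂ ∈ InBlock {κ} j
  blockSymbol-collision (yes refl) (yes refl) _ _ = (_ , refl) , (_ , refl)
  blockSymbol-collision (no j≢j₁) (no j≢j₂) e u≢v
    with punchOut∸-injective j≢j₁ j≢j₂ (cong proj₁ e′) | cong proj₂ e′
    where e′ = inj₂-injective (inj₁-injective e)
  ... | refl | refl = ⊥-elim (u≢v refl)
  blockSymbol-collision (yes _) (no _)  ()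
  blockSymbol-collision (no _)  (yes _) ()

  blockRow-collision : ∀ j u v → blockRow j u ≡ blockRow j v → u ≢ v → u ∈ InBlock j × v ∈ InBlock j
  blockRow-collision j (copy a x)    (copy a′ x′)  refl u≢v = ⊥-elim (u≢v refl)
  blockRow-collision j (copy a x)    (block j′ y)  e    _   = ⊥-elim (blockSymbol≢copy (j ≟ᶠ j′) (sym e))
  blockRow-collision j (block j′ y)  (copy a x)    e    _   = ⊥-elim (blockSymbol≢copy (j ≟ᶠ j′) e)
  blockRow-collision j (block j₁ y₁) (block j₂ y₂) e    u≢v =
    blockSymbol-collision (j ≟ᶠ j₁) (j ≟ᶠ j₂) e (u≢v ∘ cong inj₂)

  topSize blockSize : ℕ
  topSize   = κ + m * k + w₁ + w₂
  blockSize = 3 * κ + (m ∸ 1) * k + 1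

  topAlphabet : TopSymbol ↣ Fin topSize
  topAlphabet = join↣ (join↣ (join↣ (↣-id _) combine↣) (↣-id _)) (↣-id _)

  blockAlphabet : BlockSymbol ↣ Fin blockSize
  blockAlphabet = join↣ (join↣ combine↣ combine↣) (↣-id _)

  row : (i : Fin (3 + m)) → Column κ m k → Fin (pow3 topSize blockSize i)
  row zero                = Injection.to topAlphabet ∘ topRow zero
  row one                 = Injection.to topAlphabet ∘ topRow one
  row two                 = Injection.to topAlphabet ∘ topRow two
  row (suc (suc (suc j))) = Injection.to blockAlphabet ∘ blockRow j

  module Selection {t : ℕ} (c : Fin t → Column κ m k) (c-injective : Injective _≡_ _≡_ c) where

    same-value : ∀ {p p′ a a′ x x′} → c p ≡ copy a x → c p′ ≡ copy a′ x′ → p ≡ p′ → x ≡ x′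
    same-value p↦x p′↦x′ refl = copy-injective (trans (sym p↦x) p′↦x′)

    record TopCollisionIn (r a : Fin 3) : Set where
      field
        {p q}    : Fin t
        {x y}    : Fin κ
        p↦x      : c p ≡ copy a x
        q↦y      : c q ≡ copy a y
        x≢y      : x ≢ y
        collides : base (third r a) x ≡ base (third r a) y

      p≢q : p ≢ q
      p≢q = x≢y ∘ same-value p↦x q↦y

    open TopCollisionIn

    topCollision : ∀ r → Collision (topRow r ∘ c) → ∃ (TopCollisionIn r)
    topCollision r (p , q , p≢q , e) with topRow-collision r (c p) (c q) e (p≢q ∘ c-injective)
    ... | a , x , y , p↦x , q↦y , x≢y , collides =
      a , record { p↦x = p↦x ; q↦y = q↦y ; x≢y = x≢y ; collides = collides }

    pairIn : ∀ {r a} → TopCollisionIn r a → AtLeast 2 (c ⊢ InCopy a)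
    pairIn C = AtLeast-pair (p≢q C) (_ , p↦x C) (_ , q↦y C)

    kind≢zero : ∀ {r a} → TopCollisionIn r a → third r a ≢ zero
    kind≢zero C kind≡0 =
      x≢y C (base-zero-injective (subst (λ d → base d (x C) ≡ base d (y C)) kind≡0 (collides C)))

    not-all-in-one-group : ∀ {a} → TopCollisionIn zero a → TopCollisionIn one a → ¬ TopCollisionIn two a
    not-all-in-one-group {zero} C₀ _  _  = kind≢zero C₀ refl
    not-all-in-one-group {one}  _  _  C₂ = kind≢zero C₂ refl
    not-all-in-one-group {two}  _  C₁ _  = kind≢zero C₁ refl

    same-group-triple : ∀ {r r′ a} → r ≢ r′ → TopCollisionIn r a → TopCollisionIn r′ a →
      AtLeast 3 (c ⊢ InCopy a)
    same-group-triple {r} {r′} {a} r≢r′ C C′ with point-outside-pair _≟ᶠ_ (p≢q C′) other-pair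
      where
      C′-collides-on-C : (p C′ ≡ p C × q C′ ≡ q C) ⊎ (p C′ ≡ q C × q C′ ≡ p C) →
        base (third r′ a) (x C) ≡ base (third r′ a) (y C)
      C′-collides-on-C (inj₁ (p′≡p , q′≡q)) =
        subst₂ (λ u v → base _ u ≡ base _ v)
          (same-value (p↦x C′) (p↦x C) p′≡p) (same-value (q↦y C′) (q↦y C) q′≡q) (collides C′)
      C′-collides-on-C (inj₂ (p′≡q , q′≡p)) =
        sym (subst₂ (λ u v → base _ u ≡ base _ v)
          (same-value (p↦x C′) (q↦y C) p′≡q) (same-value (q↦y C′) (p↦x C) q′≡p) (collides C′))
      other-pair : ¬ ((p C′ ≡ p C × q C′ ≡ q C) ⊎ (p C′ ≡ q C × q C′ ≡ p C))
      other-pair same = r≢r′ (third-injectiveˡ a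
        (base-collides-at-most-once (x≢y C) (collides C) (C′-collides-on-C same)))
    ... | z , z≢p , z≢q , z∈C′ =
      AtLeast-triple (p≢q C) (z≢p ∘ sym) (z≢q ∘ sym) (_ , p↦x C) (_ , q↦y C) (in-a z∈C′)
      where
      in-a : ∀ {z} → z ≡ p C′ ⊎ z ≡ q C′ → c z ∈ InCopy a
      in-a (inj₁ refl) = _ , p↦x C′
      in-a (inj₂ refl) = _ , q↦y C′

    copies-∪ : ∀ {a a′ s s′} → AtLeast s (c ⊢ InCopy a) → AtLeast s′ (c ⊢ InCopy a′) → a ≢ a′ →
      AtLeast (s + s′) (c ⊢ IsCopy)
    copies-∪ U V a≢a′ = AtLeast-mono [ (_ ,_) , (_ ,_) ]′ (AtLeast-∪ U V (InCopy-disjoint a≢a′))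

    copies-occupied : ∀ {a₀ a₁ a₂} →
      TopCollisionIn zero a₀ → TopCollisionIn one a₁ → TopCollisionIn two a₂ →
      AtLeast 5 (c ⊢ IsCopy)
    copies-occupied {a₀} {a₁} {a₂} C₀ C₁ C₂ with a₀ ≟ᶠ a₁ | a₀ ≟ᶠ a₂ | a₁ ≟ᶠ a₂
    ... | yes refl | yes refl | _        = ⊥-elim (not-all-in-one-group C₀ C₁ C₂)
    ... | yes refl | no a₀≢a₂ | _        = copies-∪ (same-group-triple (λ ()) C₀ C₁) (pairIn C₂) a₀≢a₂
    ... | no a₀≢a₁ | yes refl | _        = copies-∪ (same-group-triple (λ ()) C₀ C₂) (pairIn C₁) a₀≢a₁
    ... | no a₀≢a₁ | no _     | yes refl =
      copies-∪ (same-group-triple (λ ()) C₁ C₂) (pairIn C₀) (a₀≢a₁ ∘ sym)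
    ... | no a₀≢a₁ | no a₀≢a₂ | no a₁≢a₂ = AtLeast-shrink (n≤1+n 5)
      (AtLeast-mono [ [ (_ ,_) , (_ ,_) ]′ , (_ ,_) ]′
        (AtLeast-∪ (AtLeast-∪ (pairIn C₀) (pairIn C₁) (InCopy-disjoint a₀≢a₁)) (pairIn C₂) λ where
          (inj₁ u∈a₀ , u∈a₂) → InCopy-disjoint a₀≢a₂ (u∈a₀ , u∈a₂)
          (inj₂ u∈a₁ , u∈a₂) → InCopy-disjoint a₁≢a₂ (u∈a₁ , u∈a₂)))

    blockPair : ∀ j → Collision (blockRow j ∘ c) → AtLeast 2 (c ⊢ InBlock j)
    blockPair j (p , q , p≢q , e) =
      let p∈j , q∈j = blockRow-collision j (c p) (c q) e (p≢q ∘ c-injective) in AtLeast-pair p≢q p∈j q∈j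

    no-total-collision : t ≤ 2 * m + 4 → ¬ (∀ i → Collision (row i ∘ c))
    no-total-collision t≤2m+4 collisions =
      <-irrefl refl (+-cancelˡ-≤ (2 * m) 5 4 (≤-trans 2m+5≤t t≤2m+4))
      where
      top : ∀ r → Collision (Injection.to topAlphabet ∘ topRow r ∘ c) → ∃ (TopCollisionIn r)
      top r = topCollision r ∘ collision-∘ (Injection.injective topAlphabet)
      blocks : AtLeast (m * 2) (c ⊢ IsBlock)
      blocks = AtLeast-⋃ (λ j → blockPair j
        (collision-∘ (Injection.injective blockAlphabet) (collisions (suc (suc (suc j)))))) InBlock-unique
      copies : AtLeast 5 (c ⊢ IsCopy)
      copies = copies-occupied (proj₂ (top zero (collisions zero))) (proj₂ (top one (collisions one)))
        (proj₂ (top two (collisions two)))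
      2m+5≤t : 2 * m + 5 ≤ t
      2m+5≤t = subst (λ n → n + 5 ≤ t) (*-comm m 2) (AtLeast-≤ (AtLeast-∪ blocks copies IsBlock⊥IsCopy))

  array : HHF (3 + m) (3 * κ + m * k) (pow3 topSize blockSize)
  array i = row i ∘ Inverse.to columnIndex

  construction : ∀ {t} → t ≤ 2 * m + 4 → PHHF (3 + m) (3 * κ + m * k) (pow3 topSize blockSize) t
  construction t≤2m+4 = array , IsPerfect-unless-all-collide {A = array} λ c c-injective →
    Selection.no-total-collision (Inverse.to columnIndex ∘ c)
      (λ e → c-injective (Injection.injective (↔⇒↣ columnIndex) e)) t≤2m+4

-- Arithmetic of the parameters

blockSize≤topSize : ∀ κ w₁ w₂ d {m} → d + (w₁ + w₂) ≡ 2 * κ → Fin m →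
  3 * κ + (m ∸ 1) * suc d + 1 ≤ κ + m * suc d + w₁ + w₂
blockSize≤topSize κ w₁ w₂ d {suc m} d+w≡2κ _ = ≤-reflexive
  (+-cancelʳ-≡ (2 * κ) _ _
    (trans (cong (λ x → 3 * κ + m * suc d + 1 + x) (sym d+w≡2κ)) (identity κ w₁ w₂ d m)))
  where
  identity : ∀ κ w₁ w₂ d m →
    3 * κ + m * suc d + 1 + (d + (w₁ + w₂)) ≡ κ + suc m * suc d + w₁ + w₂ + 2 * κ
  identity = solve-∀

2[3+m]∸ : ∀ m c e → c + e ≡ 6 → 2 * (3 + m) ∸ c ≡ e + 2 * m
2[3+m]∸ m c e c+e≡6 = begin
  2 * (3 + m) ∸ c        ≡⟨ cong (_∸ c) (2[3+m]≡6+2m m) ⟩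
  6 + 2 * m ∸ c          ≡⟨ cong (λ x → x + 2 * m ∸ c) (sym c+e≡6) ⟩
  c + e + 2 * m ∸ c      ≡⟨ cong (_∸ c) (+-assoc c e (2 * m)) ⟩
  c + (e + 2 * m) ∸ c    ≡⟨ m+n∸m≡n c (e + 2 * m) ⟩
  e + 2 * m              ∎
  where
  open ≡-Reasoning
  2[3+m]≡6+2m : ∀ m → 2 * (3 + m) ≡ 6 + 2 * m
  2[3+m]≡6+2m = solve-∀

pos-∸ : ∀ {m n} → n ≤ m → + (m ∸ n) ≡ + m -ℤ + n
pos-∸ {m} {n} n≤m = trans (sym (⊖-≥ n≤m)) (sym (m-n≡m⊖n m n))

columns-identity : ∀ K M W →
  + 3 *ℤ K +ℤ M *ℤ (+ 1 +ℤ (+ 2 *ℤ K -ℤ W)) ≡ (+ 3 +ℤ + 2 *ℤ M) *ℤ K -ℤ M *ℤ (W -ℤ + 1)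
columns-identity = ℤ-Solver.solve-∀

symbols-identity : ∀ K M W₁ W₂ → K +ℤ M *ℤ (+ 1 +ℤ (+ 2 *ℤ K -ℤ (W₁ +ℤ W₂))) +ℤ W₁ +ℤ W₂ ≡
  (+ 1 +ℤ + 2 *ℤ M) *ℤ K -ℤ (+ 3 +ℤ M -ℤ + 4) *ℤ ((W₁ +ℤ W₂) -ℤ + 1) +ℤ + 1
symbols-identity = ℤ-Solver.solve-∀

module _ (κ w₁ w₂ m d : ℕ) (d≡2κ-w : + d ≡ + 2 *ℤ + κ -ℤ (+ w₁ +ℤ + w₂)) where

  private
    W : ℤ
    W = + w₁ +ℤ + w₂

    coefficient : ∀ c e → c + e ≡ 6 → + (2 * (3 + m) ∸ c) ≡ + e +ℤ + 2 *ℤ + m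
    coefficient c e c+e≡6 =
      trans (cong +_ (2[3+m]∸ m c e c+e≡6)) (trans (pos-+ e (2 * m)) (cong (+ e +ℤ_) (pos-* 2 m)))

    blocks≡ : + (m * suc d) ≡ + m *ℤ (+ 1 +ℤ (+ 2 *ℤ + κ -ℤ W))
    blocks≡ = trans (pos-* m (suc d)) (cong (+ m *ℤ_) (trans (pos-+ 1 d) (cong (+ 1 +ℤ_) d≡2κ-w)))

  columns-formula : + (3 * κ + m * suc d) ≡ + (2 * (3 + m) ∸ 3) *ℤ + κ -ℤ + m *ℤ (W -ℤ + 1)
  columns-formula = begin
    + (3 * κ + m * suc d)                             ≡⟨ pos-+ (3 * κ) (m * suc d) ⟩
    + (3 * κ) +ℤ + (m * suc d)                        ≡⟨ cong₂ _+ℤ_ (pos-* 3 κ) blocks≡ ⟩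
    + 3 *ℤ + κ +ℤ + m *ℤ (+ 1 +ℤ (+ 2 *ℤ + κ -ℤ W))  ≡⟨ columns-identity (+ κ) (+ m) W ⟩
    (+ 3 +ℤ + 2 *ℤ + m) *ℤ + κ -ℤ + m *ℤ (W -ℤ + 1)
      ≡⟨ cong (λ x → x *ℤ + κ -ℤ + m *ℤ (W -ℤ + 1)) (sym (coefficient 3 3 refl)) ⟩
    + (2 * (3 + m) ∸ 3) *ℤ + κ -ℤ + m *ℤ (W -ℤ + 1)   ∎
    where open ≡-Reasoning

  symbols-formula : + (κ + m * suc d + w₁ + w₂) ≡
    + (2 * (3 + m) ∸ 5) *ℤ + κ -ℤ (+ (3 + m) -ℤ + 4) *ℤ (W -ℤ + 1) +ℤ + 1
  symbols-formula = begin
    + (κ + m * suc d + w₁ + w₂)                        ≡⟨ pos-+ (κ + m * suc d + w₁) w₂ ⟩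
    + (κ + m * suc d + w₁) +ℤ + w₂                     ≡⟨ cong (_+ℤ + w₂) (pos-+ (κ + m * suc d) w₁) ⟩
    + (κ + m * suc d) +ℤ + w₁ +ℤ + w₂
      ≡⟨ cong (λ x → x +ℤ + w₁ +ℤ + w₂) (trans (pos-+ κ (m * suc d)) (cong (+ κ +ℤ_) blocks≡)) ⟩
    + κ +ℤ + m *ℤ (+ 1 +ℤ (+ 2 *ℤ + κ -ℤ W)) +ℤ + w₁ +ℤ + w₂
      ≡⟨ symbols-identity (+ κ) (+ m) (+ w₁) (+ w₂) ⟩
    (+ 1 +ℤ + 2 *ℤ + m) *ℤ + κ -ℤ (+ 3 +ℤ + m -ℤ + 4) *ℤ (W -ℤ + 1) +ℤ + 1
      ≡⟨ cong₂ (λ x y → x *ℤ + κ -ℤ (y -ℤ + 4) *ℤ (W -ℤ + 1) +ℤ + 1)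
           (sym (coefficient 5 1 refl)) (sym (pos-+ 3 m)) ⟩
    + (2 * (3 + m) ∸ 5) *ℤ + κ -ℤ (+ (3 + m) -ℤ + 4) *ℤ (W -ℤ + 1) +ℤ + 1 ∎
    where open ≡-Reasoning

lemma20 : (κ w₁ w₂ n : ℕ) → PHHF 2 κ (pair w₁ w₂) 2 → n ≥ 3 →
    ((k : ℕ) → k ≥ 1 →
      PHHF n (3 * κ + (n ∸ 3) * k)
        (pow3 (κ + (n ∸ 3) * k + w₁ + w₂) (3 * κ + (n ∸ 4) * k + 1))
        (2 * n ∸ 2))
    × (w₁ + w₂ ≤ 2 * κ →
      ∃₂ λ (k' v' : ℕ) →
        (+ k' ≡ (+ (2 * n ∸ 3) *ℤ + κ) -ℤ (+ (n ∸ 3) *ℤ ((+ w₁ +ℤ + w₂) -ℤ + 1)))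
        × (+ v' ≡ ((+ (2 * n ∸ 5) *ℤ + κ) -ℤ ((+ n -ℤ + 4) *ℤ ((+ w₁ +ℤ + w₂) -ℤ + 1))) +ℤ + 1)
        × PHF n k' v' (2 * n ∸ 2))
lemma20 κ w₁ w₂ zero _ ()
lemma20 κ w₁ w₂ (suc zero) _ (s≤s ())
lemma20 κ w₁ w₂ (suc (suc zero)) _ (s≤s (s≤s ()))
lemma20 κ w₁ w₂ (suc (suc (suc m))) (P , P-perfect) _ =
  (λ k _ → Construction.construction P P-perfect m k strength) ,
  -- k = 2κ − (w₁ + w₂) + 1 makes both alphabets κ + m k + w₁ + w₂.
  λ w≤2κ → let d = 2 * κ ∸ (w₁ + w₂)
               d≡2κ-w = trans (pos-∸ {2 * κ} {w₁ + w₂} w≤2κ) (cong₂ _-ℤ_ (pos-* 2 κ) (pos-+ w₁ w₂)) in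
    _ , _ , columns-formula κ w₁ w₂ m d d≡2κ-w , symbols-formula κ w₁ w₂ m d d≡2κ-w ,
    PHHF-mono (pow3≤ (blockSize≤topSize κ w₁ w₂ d (m∸n+n≡m w≤2κ)))
      (Construction.construction P P-perfect m (suc d) strength)
  where
  strength : 2 * (3 + m) ∸ 2 ≤ 2 * m + 4
  strength = ≤-reflexive (trans (2[3+m]∸ m 2 4 refl) (+-comm 4 (2 * m)))
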